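{- Let $(X,\{R_i\}_{i=0}^5)$ be a skew-symmetric association scheme on triples, where $R_0,\dots,R_3$ are the trivial relations, with intersection numbers satisfying $p_{444}^4=p_{445}^5=p_{455}^4=p_{555}^5=0$. Then $(X,\nabla)$ is a regular skew two-graph, where $\nabla=\{(xyz)\in\mathcal C_3:(x,y,z)\in R_4\}$.
   Context: $X$ is a finite set, $\mathcal C_3$ is the set of $3$-cycles in the symmetric group on $X$; $(xyz)$ denotes the $3$-cycle $x\mapsto y\mapsto z\mapsto x$. A skew two-graph is a pair $(X,\nabla)$ with $\nabla\subseteq\mathcal C_3$ such that (S1) for every $\tau\in\mathcal C_3$ exactly one of $\tau,\tau^{ -1}$ is in $\nabla$ and (S2) for every $4$-subset $\{x,y,z,w\}\subseteq X$, $\nabla$ contains an even number of $(xyz),(xwy),(xzw),(ywz)$; it is regular if the number of $z$ with $(xyz)\in\nabla$ is the same for all ordered pairs of distinct $x,y$. The trivial relations are $R_0=\{(x,x,x)\}$, $R_1=\{(x,y,y):x\ne y\}$, $R_2=\{(x,y,x):x\neq y\}$, $R_3=\{(x,x,y):x\neq y\}$. For $\sigma\in S_3$ and $R\subseteq X^3$, $\sigma(R)=\{(y_{\sigma(1)},y_{\sigma(2)},y_{\sigma(3)}):(y_1,y_2,y_3)\in R\}$. A partition $\{R_0,\dots,R_m\}$ of $X^3$ is an association scheme on triples if: (I) $R_0,\dots,R_3$ are the trivial relations; (II) for each $i$ and $\sigma\in S_3$, $\sigma(R_i)=R_j$ for some $j$; (III) for distinct $y,z$ and each $i$, $|\{x:(x,y,z)\in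 R_i\}|$ depends only on $i$; (IV) for all $i,j,k,\ell$ and $(x,y,z)\in R_\ell$, the number $p_{ijk}^\ell=|\{w\in X:(w,y,z)\in R_i,(x,w,z)\in R_j,(x,y,w)\in R_k\}|$ depends only on $i,j,k,\ell$. Such a scheme with $m=5$ is skew-symmetric if (SS1) $R_4,R_5$ are invariant under $(123)\in S_3$ and (SS2) $\sigma(R_4)\cap R_4=\sigma(R_5)\cap R_5=\emptyset$ for $\sigma=(12)$. -}

module Defs where

open import Level using (Level)
open import Data.Bool using (Bool; true; false; if_then_else_)
open import Data.Nat using (ℕ; _+_)
open import Data.Fin using (Fin; #_; _≟_)
open import Data.Fin.Properties using (any?; all?)
open import Data.Fin.Permutation using (Permutation′; _⟨$⟩ʳ_; transpose; _∘ₚ_)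
open import Data.List using (filter; length; allFin)
open import Data.Vec using (lookup; _∷_; [])
open import Data.Product using (Σ; _×_; _,_; ∃; ∃-syntax)
open import Data.Sum using (_⊎_)
open import Data.Empty using (⊥)
open import Relation.Nullary using (Dec; ¬_; ¬?; _×-dec_; isYes)
open import Relation.Unary using (Pred; Decidable)
open import Relation.Binary.PropositionalEquality using (_≡_; _≢_)
open import Function.Bundles using (_⇔_)

card : ∀ {n : ℕ} {ℓ : Level} {P : Pred (Fin n) ℓ} → Decidable P → ℕ
card {n} P? = length (filter P? (allFin n))

ind : ∀ {ℓ} {A : Set ℓ} → Dec A → ℕ
ind d = if isYes d then 1 else 0

Triple : ℕ → Set
Triple n = Fin n × Fin n × Fin n

Rel3 : ℕ → Set₁
Rel3 n = Triple n → Set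

_≐_ : ∀ {n} → Rel3 n → Rel3 n → Set
R ≐ S = ∀ t → R t ⇔ S t

act : ∀ {n} → Permutation′ 3 → Triple n → Triple n
act σ (y₁ , y₂ , y₃) =
  let y = lookup (y₁ ∷ y₂ ∷ y₃ ∷ []) in
  y (σ ⟨$⟩ʳ # 0) , y (σ ⟨$⟩ʳ # 1) , y (σ ⟨$⟩ʳ # 2)

image : ∀ {n} → Permutation′ 3 → Rel3 n → Rel3 n
image σ R t = ∃[ y ] (R y × act σ y ≡ t)

-- The permutations (12) and (123) of S₃ (positions 1,2,3 are # 0, # 1, # 2).
-- (12): swaps 1 and 2.  (123): 1 ↦ 2 ↦ 3 ↦ 1.
σ₁₂ : Permutation′ 3
σ₁₂ = transpose (# 0) (# 1)

σ₁₂₃ : Permutation′ 3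
σ₁₂₃ = transpose (# 0) (# 1) ∘ₚ transpose (# 0) (# 2)

-- Association schemes on triples with m = 5 (six relations).
-- The partition {R₀,…,R₅} of X^3 is given by the colouring
-- c : X^3 → Fin 6, with R_i = {t : c t ≡ i}; partition cells are nonempty.

Rel : ∀ {n} → (Triple n → Fin 6) → Fin 6 → Rel3 n
Rel c i t = c t ≡ i

T₀ T₁ T₂ T₃ : ∀ {n} → Rel3 n
T₀ (x , y , z) = x ≡ y × y ≡ z
T₁ (x , y , z) = x ≢ y × y ≡ z
T₂ (x , y , z) = x ≢ y × z ≡ x
T₃ (x , y , z) = x ≡ y × x ≢ z

record IsATS6 (n : ℕ) (c : Triple n → Fin 6)
              (p : Fin 6 → Fin 6 → Fin 6 → Fin 6 → ℕ) : Set₁ where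
  field
    nonempty : ∀ i → ∃[ t ] (c t ≡ i)
    trivial₀ : Rel c (# 0) ≐ T₀
    trivial₁ : Rel c (# 1) ≐ T₁
    trivial₂ : Rel c (# 2) ≐ T₂
    trivial₃ : Rel c (# 3) ≐ T₃
    closed : ∀ (σ : Permutation′ 3) i → ∃[ j ] (image σ (Rel c i) ≐ Rel c j)
    valency : Σ (Fin 6 → ℕ) λ a → (∀ (y z : Fin n) → y ≢ z → ∀ i →
                card (λ x → c (x , y , z) ≟ i) ≡ a i)
    -- (IV): p i j k ℓ is the intersection number p_{ijk}^ℓ
    intersection : ∀ i j k ℓ x y z → c (x , y , z) ≡ ℓ →
      card (λ w → (c (w , y , z) ≟ i) ×-dec (c (x , w , z) ≟ j)
                    ×-dec (c (x , y , w) ≟ k))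
        ≡ p i j k ℓ

record IsSkewATS6 (n : ℕ) (c : Triple n → Fin 6)
                  (p : Fin 6 → Fin 6 → Fin 6 → Fin 6 → ℕ) : Set₁ where
  field
    isATS : IsATS6 n c p
    rot₄ : image σ₁₂₃ (Rel c (# 4)) ≐ Rel c (# 4)
    rot₅ : image σ₁₂₃ (Rel c (# 5)) ≐ Rel c (# 5)
    skew₄ : ∀ t → image σ₁₂ (Rel c (# 4)) t → Rel c (# 4) t → ⊥
    skew₅ : ∀ t → image σ₁₂ (Rel c (# 5)) t → Rel c (# 5) t → ⊥

-- 3-cycles and skew two-graphs.  Permutations of X are represented by
-- their underlying functions Fin n → Fin n (compared pointwise).

Distinct3 : ∀ {n} → Fin n → Fin n → Fin n → Set
Distinct3 x y z = x ≢ y × y ≢ z × x ≢ z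

distinct3? : ∀ {n} (x y z : Fin n) → Dec (Distinct3 x y z)
distinct3? x y z = ¬? (x ≟ y) ×-dec ¬? (y ≟ z) ×-dec ¬? (x ≟ z)

cyc : ∀ {n} → Fin n → Fin n → Fin n → Fin n → Fin n
cyc x y z w with isYes (w ≟ x) | isYes (w ≟ y) | isYes (w ≟ z)
... | true  | _     | _     = y
... | false | true  | _     = z
... | false | false | true  = x
... | false | false | false = w

IsThreeCycle : ∀ {n} → (Fin n → Fin n) → Set
IsThreeCycle {n} f =
  ∃[ x ] ∃[ y ] ∃[ z ] (Distinct3 x y z × (∀ w → f w ≡ cyc x y z w))

record IsSkewTwoGraph (n : ℕ) (∇ : (Fin n → Fin n) → Set)
                      (∇? : ∀ f → Dec (∇ f)) : Set where
  field
    subset : ∀ f → ∇ f → IsThreeCycle f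
    S1 : ∀ x y z → Distinct3 x y z →
           (∇ (cyc x y z) × ¬ ∇ (cyc x z y)) ⊎ (¬ ∇ (cyc x y z) × ∇ (cyc x z y))
    S2 : ∀ x y z w → Distinct3 x y z → x ≢ w → y ≢ w → z ≢ w →
           ∃[ k ] (ind (∇? (cyc x y z)) + ind (∇? (cyc x w y))
                   + ind (∇? (cyc x z w)) + ind (∇? (cyc y w z)) ≡ 2 Data.Nat.* k)

record IsRegularSkewTwoGraph (n : ℕ) (∇ : (Fin n → Fin n) → Set)
                             (∇? : ∀ f → Dec (∇ f)) : Set where
  field
    skewTwoGraph : IsSkewTwoGraph n ∇ ∇?
    regular : ∃[ k ] (∀ x y → x ≢ y → card (λ z → ∇? (cyc x y z)) ≡ k)

Nabla : ∀ {n} → (Triple n → Fin 6) → (Fin n → Fin n) → Set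
Nabla c f = ∃[ x ] ∃[ y ] ∃[ z ]
  (Distinct3 x y z × (∀ w → f w ≡ cyc x y z w) × c (x , y , z) ≡ # 4)

Nabla? : ∀ {n} (c : Triple n → Fin 6) → ∀ f → Dec (Nabla c f)
Nabla? c f = any? λ x → any? λ y → any? λ z →
  distinct3? x y z ×-dec all? (λ w → f w ≟ cyc x y z w) ×-dec (c (x , y , z) ≟ # 4)

-- For distinct x, y, z the colour of (x,y,z) is 4 or 5; colour 4 is invariant under
-- rotation and flips under a transposition (skew-symmetry). Hence (xyz) ∈ ∇ exactly when
-- (x,y,z) ∈ R₄, which gives (S1), and regularity is the valency of R₄.
-- For (S2), the 3-cycles (xyz), (xwy), (xzw), (ywz) are the consistently oriented faces
-- of the tetrahedron xyzw. If an odd number of them lay in ∇, one face would be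
-- oriented differently from the other three; relabelling the tetrahedron so that this
-- face comes first yields (x,y,z), (w,y,z), (x,w,z), (x,y,w) all in R₄, or all in R₅
-- and then all in R₄ after swapping x and y, i.e. a configuration counted by p₄₄₄⁴.

module Submission where

open import Defs
open import Data.Bool using (Bool; true; false; not; if_then_else_)
open import Data.Bool.Properties using (not-involutive)
open import Data.Empty using (⊥; ⊥-elim)
open import Data.Fin using (Fin; #_; zero; suc; _≟_)
open import Data.List using (List; length; allFin)
open import Data.List.Membership.Propositional using (_∈_)
open import Data.List.Membership.Propositional.Properties using (∈-filter⁺; ∈-allFin)
open import Data.List.Properties using (filter-≐)
open import Data.List.Relation.Unary.Any using (here; there)
open import Data.Nat using (ℕ; _+_; _*_)
open import Data.Product using (_×_; _,_; ∃-syntax; proj₁; proj₂)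
open import Data.Sum using (_⊎_; inj₁; inj₂)
import Data.Sum as Sum
open import Function using (case_of_)
open import Function.Bundles using (_⇔_; mk⇔; Equivalence)
open import Relation.Nullary using (Dec; yes; no; ¬_; isYes)
open import Relation.Nullary.Decidable using (does-⇔; isYes≗does)
open import Relation.Unary using (Pred; Decidable)
import Relation.Unary as Pred
open import Relation.Binary.PropositionalEquality
  using (_≡_; _≢_; _≗_; refl; sym; trans; cong; ≢-sym)

open Equivalence using (to; from)

𝟙 : Bool → ℕ
𝟙 b = if b then 1 else 0

isYes-⇔ : ∀ {a b} {A : Set a} {B : Set b} → A ⇔ B → (a? : Dec A) (b? : Dec B) →
          isYes a? ≡ isYes b?
isYes-⇔ A⇔B a? b? =
  trans (isYes≗does a?) (trans (does-⇔ A⇔B a? b?) (sym (isYes≗does b?)))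

exactly-one : ∀ {a b} {A : Set a} {B : Set b} (a? : Dec A) (b? : Dec B) →
              isYes b? ≡ not (isYes a?) → (A × ¬ B) ⊎ (¬ A × B)
exactly-one (yes a) (no ¬b) _ = inj₁ (a , ¬b)
exactly-one (no ¬a) (yes b) _ = inj₂ (¬a , b)

OddOneOut : Bool → Bool → Bool → Bool → Set
OddOneOut a b c d = b ≡ not a × c ≡ not a × d ≡ not a

even-unless-odd-one-out : ∀ a b c d →
  ¬ OddOneOut a b c d → ¬ OddOneOut b c a d → ¬ OddOneOut c a b d → ¬ OddOneOut d b a c →
  ∃[ k ] (𝟙 a + 𝟙 b + 𝟙 c + 𝟙 d ≡ 2 * k)
even-unless-odd-one-out true  true  true  true  _ _ _ _ = 2 , refl
even-unless-odd-one-out true  true  true  false _ _ _ ¬d = ⊥-elim (¬d (refl , refl , refl))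
even-unless-odd-one-out true  true  false true  _ _ ¬c _ = ⊥-elim (¬c (refl , refl , refl))
even-unless-odd-one-out true  true  false false _ _ _ _ = 1 , refl
even-unless-odd-one-out true  false true  true  _ ¬b _ _ = ⊥-elim (¬b (refl , refl , refl))
even-unless-odd-one-out true  false true  false _ _ _ _ = 1 , refl
even-unless-odd-one-out true  false false true  _ _ _ _ = 1 , refl
even-unless-odd-one-out true  false false false ¬a _ _ _ = ⊥-elim (¬a (refl , refl , refl))
even-unless-odd-one-out false true  true  true  ¬a _ _ _ = ⊥-elim (¬a (refl , refl , refl))
even-unless-odd-one-out false true  true  false _ _ _ _ = 1 , refl
even-unless-odd-one-out false true  false true  _ _ _ _ = 1 , refl
even-unless-odd-one-out false true  false false _ ¬b _ _ = ⊥-elim (¬b (refl , refl , refl))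
even-unless-odd-one-out false false true  true  _ _ _ _ = 1 , refl
even-unless-odd-one-out false false true  false _ _ ¬c _ = ⊥-elim (¬c (refl , refl , refl))
even-unless-odd-one-out false false false true  _ _ _ ¬d = ⊥-elim (¬d (refl , refl , refl))
even-unless-odd-one-out false false false false _ _ _ _ = 0 , refl

card-cong : ∀ {n ℓ₁ ℓ₂} {P : Pred (Fin n) ℓ₁} {Q : Pred (Fin n) ℓ₂}
            (P? : Decidable P) (Q? : Decidable Q) → P Pred.≐ Q → card P? ≡ card Q?
card-cong P? Q? P≐Q = cong length (filter-≐ P? Q? P≐Q (allFin _))

card≡0⇒empty : ∀ {n ℓ} {P : Pred (Fin n) ℓ} (P? : Decidable P) → card P? ≡ 0 →
               ∀ x → ¬ P x
card≡0⇒empty P? card≡0 x Px = nonempty (∈-filter⁺ P? (∈-allFin x) Px) card≡0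
  where
  nonempty : ∀ {A : Set} {a : A} {as : List A} → a ∈ as → length as ≢ 0
  nonempty (here _)  ()
  nonempty (there _) ()

data Rotation {A : Set} : A × A × A → A × A × A → Set where
  rotate⁰ : ∀ {a b d} → Rotation (a , b , d) (a , b , d)
  rotate¹ : ∀ {a b d} → Rotation (a , b , d) (b , d , a)
  rotate² : ∀ {a b d} → Rotation (a , b , d) (d , a , b)

same-cycle⇒Rotation : ∀ {A : Set} (f : A → A) {x y z a b d : A} →
  f x ≡ y → f y ≡ z → f a ≡ b → f b ≡ d → f d ≡ a → x ≡ a ⊎ x ≡ b ⊎ x ≡ d →
  Rotation (a , b , d) (x , y , z)
same-cycle⇒Rotation f fx fy fa fb fd (inj₁ refl) with trans (sym fx) fa
... | refl with trans (sym fy) fb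
... | refl = rotate⁰
same-cycle⇒Rotation f fx fy fa fb fd (inj₂ (inj₁ refl)) with trans (sym fx) fb
... | refl with trans (sym fy) fd
... | refl = rotate¹
same-cycle⇒Rotation f fx fy fa fb fd (inj₂ (inj₂ refl)) with trans (sym fx) fd
... | refl with trans (sym fy) fa
... | refl = rotate²

no-three-distinct-in-pair : ∀ {n} {a b d x y : Fin n} → Distinct3 a b d →
  a ≡ x ⊎ a ≡ y → b ≡ x ⊎ b ≡ y → d ≡ x ⊎ d ≡ y → ⊥
no-three-distinct-in-pair (a≢b , _ , _) (inj₁ refl) (inj₁ refl) _ = a≢b refl
no-three-distinct-in-pair (a≢b , _ , _) (inj₂ refl) (inj₂ refl) _ = a≢b refl
no-three-distinct-in-pair (_ , _ , a≢d) (inj₁ refl) (inj₂ refl) (inj₁ refl) = a≢d refl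
no-three-distinct-in-pair (_ , b≢d , _) (inj₁ refl) (inj₂ refl) (inj₂ refl) = b≢d refl
no-three-distinct-in-pair (_ , b≢d , _) (inj₂ refl) (inj₁ refl) (inj₁ refl) = b≢d refl
no-three-distinct-in-pair (_ , _ , a≢d) (inj₂ refl) (inj₁ refl) (inj₂ refl) = a≢d refl

module _ {n : ℕ} where

  cyc-at₁ : (x y z : Fin n) → cyc x y z x ≡ y
  cyc-at₁ x y z with x ≟ x
  ... | yes _   = refl
  ... | no x≢x = ⊥-elim (x≢x refl)

  cyc-at₂ : ∀ {x y : Fin n} z → y ≢ x → cyc x y z y ≡ z
  cyc-at₂ {x} {y} z y≢x with y ≟ x | y ≟ y
  ... | yes y≡x | _       = ⊥-elim (y≢x y≡x)
  ... | no _    | yes _   = refl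
  ... | no _    | no y≢y = ⊥-elim (y≢y refl)

  cyc-at₃ : ∀ {x y z : Fin n} → z ≢ x → z ≢ y → cyc x y z z ≡ x
  cyc-at₃ {x} {y} {z} z≢x z≢y with z ≟ x | z ≟ y | z ≟ z
  ... | yes z≡x | _       | _       = ⊥-elim (z≢x z≡x)
  ... | no _    | yes z≡y | _       = ⊥-elim (z≢y z≡y)
  ... | no _    | no _    | yes _   = refl
  ... | no _    | no _    | no z≢z = ⊥-elim (z≢z refl)

  cyc-support : ∀ {x y z w : Fin n} → cyc x y z w ≢ w → w ≡ x ⊎ w ≡ y ⊎ w ≡ z
  cyc-support {x} {y} {z} {w} moved with w ≟ x | w ≟ y | w ≟ z
  ... | yes w≡x | _       | _       = inj₁ w≡x
  ... | no _    | yes w≡y | _       = inj₂ (inj₁ w≡y)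
  ... | no _    | no _    | yes w≡z = inj₂ (inj₂ w≡z)
  ... | no _    | no _    | no _    = ⊥-elim (moved refl)

  cyc-support-degenerate : ∀ {x y z w : Fin n} → z ≡ x ⊎ z ≡ y →
                           cyc x y z w ≢ w → w ≡ x ⊎ w ≡ y
  cyc-support-degenerate z∈xy moved with cyc-support moved
  ... | inj₁ w≡x        = inj₁ w≡x
  ... | inj₂ (inj₁ w≡y) = inj₂ w≡y
  ... | inj₂ (inj₂ w≡z) = Sum.map (trans w≡z) (trans w≡z) z∈xy

  cyc-moves : ∀ {a b d : Fin n} → Distinct3 a b d →
              cyc a b d a ≢ a × cyc a b d b ≢ b × cyc a b d d ≢ d
  cyc-moves {a} {b} {d} (a≢b , b≢d , a≢d) =
      (λ e → a≢b (trans (sym e) (cyc-at₁ a b d)))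
    , (λ e → b≢d (trans (sym e) (cyc-at₂ d (≢-sym a≢b))))
    , (λ e → a≢d (sym (trans (sym e) (cyc-at₃ (≢-sym a≢d) (≢-sym b≢d)))))

  -- If z ∈ {x, y} then cyc x y z moves only x and y, whereas a 3-cycle moves three points.
  IsThreeCycle-cyc⇒Distinct3 : ∀ {x y z : Fin n} → x ≢ y → IsThreeCycle (cyc x y z) →
                               Distinct3 x y z
  IsThreeCycle-cyc⇒Distinct3 {x} {y} {z} x≢y (a , b , d , abd , f≗g) =
    x≢y , (λ y≡z → degenerate (inj₂ (sym y≡z))) , (λ x≡z → degenerate (inj₁ (sym x≡z)))
    where
    moved : ∀ u → cyc a b d u ≢ u → cyc x y z u ≢ u
    moved u g≢ f≡ = g≢ (trans (sym (f≗g u)) f≡)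
    degenerate : z ≡ x ⊎ z ≡ y → ⊥
    degenerate z∈xy with cyc-moves abd
    ... | ma , mb , md = no-three-distinct-in-pair abd
      (cyc-support-degenerate z∈xy (moved a ma))
      (cyc-support-degenerate z∈xy (moved b mb))
      (cyc-support-degenerate z∈xy (moved d md))

  cyc-≗⇒Rotation : ∀ {x y z a b d : Fin n} → Distinct3 x y z → Distinct3 a b d →
                   cyc x y z ≗ cyc a b d → Rotation (a , b , d) (x , y , z)
  cyc-≗⇒Rotation {x} {y} {z} {a} {b} {d} (x≢y , _ , _) (a≢b , b≢d , a≢d) f≗g =
    same-cycle⇒Rotation (cyc a b d) gx gy
      (cyc-at₁ a b d) (cyc-at₂ d (≢-sym a≢b)) (cyc-at₃ (≢-sym a≢d) (≢-sym b≢d))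
      (cyc-support (λ gx≡x → x≢y (trans (sym gx≡x) gx)))
    where
    gx : cyc a b d x ≡ y
    gx = trans (sym (f≗g x)) (cyc-at₁ x y z)
    gy : cyc a b d y ≡ z
    gy = trans (sym (f≗g y)) (cyc-at₂ z (≢-sym x≢y))

Nabla⇒IsThreeCycle : ∀ {n} {c : Triple n → Fin 6} {f : Fin n → Fin n} →
                     Nabla c f → IsThreeCycle f
Nabla⇒IsThreeCycle (x , y , z , xyz , f≗ , _) = x , y , z , xyz , f≗

Distinct4 : ∀ {n} → Fin n → Fin n → Fin n → Fin n → Set
Distinct4 x y z w = x ≢ y × x ≢ z × x ≢ w × y ≢ z × y ≢ w × z ≢ w

intersection≡0⇒no-configuration :
  ∀ {n c p} → IsATS6 n c p → ∀ {i j k ℓ} {x y z w : Fin n} → p i j k ℓ ≡ 0 →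
  c (x , y , z) ≡ ℓ → c (w , y , z) ≡ i → c (x , w , z) ≡ j → c (x , y , w) ≡ k → ⊥
intersection≡0⇒no-configuration ats {i} {j} {k} {ℓ} {x} {y} {z} {w} p≡0 xyz∈Rℓ
                                wyz∈Rᵢ xwz∈Rⱼ xyw∈Rₖ =
  card≡0⇒empty _ (trans (IsATS6.intersection ats i j k ℓ x y z xyz∈Rℓ) p≡0) w
    (wyz∈Rᵢ , xwz∈Rⱼ , xyw∈Rₖ)

module SkewSymmetricScheme {n : ℕ} {c : Triple n → Fin 6}
                           {p : Fin 6 → Fin 6 → Fin 6 → Fin 6 → ℕ}
                           (S : IsSkewATS6 n c p) where
  open IsSkewATS6 S
  open IsATS6 isATS

  R₄-rotate : ∀ {a b d} → c (a , b , d) ≡ # 4 → c (b , d , a) ≡ # 4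
  R₄-rotate {a} {b} {d} abd∈R₄ = to (rot₄ (b , d , a)) ((a , b , d) , abd∈R₄ , refl)

  R₄-Rotation : ∀ {t u} → Rotation t u → c t ≡ # 4 → c u ≡ # 4
  R₄-Rotation rotate⁰ t∈R₄ = t∈R₄
  R₄-Rotation rotate¹ t∈R₄ = R₄-rotate t∈R₄
  R₄-Rotation rotate² t∈R₄ = R₄-rotate (R₄-rotate t∈R₄)

  R₄⇒Distinct3 : ∀ {a b d} → c (a , b , d) ≡ # 4 → Distinct3 a b d
  R₄⇒Distinct3 {a} {b} {d} abd∈R₄ = a≢b , b≢d , a≢d
    where
    trivial-colour : ∀ {i} {T : Rel3 n} → Rel c i ≐ T → T (a , b , d) → i ≡ # 4
    trivial-colour Rᵢ≐T abd∈T = trans (sym (from (Rᵢ≐T _) abd∈T)) abd∈R₄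
    a≢b : a ≢ b
    a≢b a≡b with b ≟ d
    ... | yes b≡d = case trivial-colour trivial₀ (a≡b , b≡d) of λ ()
    ... | no  b≢d =
      case trivial-colour trivial₃ (a≡b , λ a≡d → b≢d (trans (sym a≡b) a≡d)) of λ ()
    b≢d : b ≢ d
    b≢d b≡d with a ≟ b
    ... | yes a≡b = case trivial-colour trivial₀ (a≡b , b≡d) of λ ()
    ... | no  a≢b = case trivial-colour trivial₁ (a≢b , b≡d) of λ ()
    a≢d : a ≢ d
    a≢d a≡d with a ≟ b
    ... | yes a≡b = case trivial-colour trivial₀ (a≡b , trans (sym a≡b) a≡d) of λ ()
    ... | no  a≢b = case trivial-colour trivial₂ (a≢b , sym a≡d) of λ ()

  Distinct3∖R₄⇒R₅ : ∀ {a b d} → Distinct3 a b d → c (a , b , d) ≢ # 4 → c (a , b , d) ≡ # 5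
  Distinct3∖R₄⇒R₅ {a} {b} {d} (a≢b , b≢d , a≢d) abd∉R₄ with c (a , b , d) in abd∈R
  ... | zero                             = ⊥-elim (a≢b (proj₁ (to (trivial₀ _) abd∈R)))
  ... | suc zero                         = ⊥-elim (b≢d (proj₂ (to (trivial₁ _) abd∈R)))
  ... | suc (suc zero)                   = ⊥-elim (a≢d (sym (proj₂ (to (trivial₂ _) abd∈R))))
  ... | suc (suc (suc zero))             = ⊥-elim (a≢b (proj₁ (to (trivial₃ _) abd∈R)))
  ... | suc (suc (suc (suc zero)))       = ⊥-elim (abd∉R₄ refl)
  ... | suc (suc (suc (suc (suc zero)))) = refl

  r₄ : Triple n → Bool
  r₄ t = isYes (c t ≟ # 4)

  r₄≡true⇒R₄ : ∀ t → r₄ t ≡ true → c t ≡ # 4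
  r₄≡true⇒R₄ t _ with c t ≟ # 4
  ... | yes t∈R₄ = t∈R₄

  r₄-rotate : ∀ a b d → r₄ (b , d , a) ≡ r₄ (a , b , d)
  r₄-rotate a b d = isYes-⇔ (mk⇔ (λ bda∈R₄ → R₄-rotate (R₄-rotate bda∈R₄)) R₄-rotate) _ _

  r₄-rotate² : ∀ a b d → r₄ (d , a , b) ≡ r₄ (a , b , d)
  r₄-rotate² a b d = trans (r₄-rotate b d a) (r₄-rotate a b d)

  r₄-swap₁₂ : ∀ {a b d} → Distinct3 a b d → r₄ (b , a , d) ≡ not (r₄ (a , b , d))
  r₄-swap₁₂ {a} {b} {d} abd@(a≢b , b≢d , a≢d) with c (a , b , d) ≟ # 4 | c (b , a , d) ≟ # 4
  ... | yes abd∈R₄ | yes bad∈R₄ = ⊥-elim (skew₄ _ ((a , b , d) , abd∈R₄ , refl) bad∈R₄)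
  ... | yes _      | no _       = refl
  ... | no _       | yes _      = refl
  ... | no abd∉R₄  | no bad∉R₄  = ⊥-elim (skew₅ _
          ((a , b , d) , Distinct3∖R₄⇒R₅ abd abd∉R₄ , refl)
          (Distinct3∖R₄⇒R₅ (≢-sym a≢b , a≢d , b≢d) bad∉R₄))

  r₄-swap₂₃ : ∀ {a b d} → Distinct3 a b d → r₄ (a , d , b) ≡ not (r₄ (a , b , d))
  r₄-swap₂₃ {a} {b} {d} (a≢b , b≢d , a≢d) =
    trans (r₄-swap₁₂ (≢-sym a≢d , a≢b , ≢-sym b≢d)) (cong not (r₄-rotate² a b d))

  r₄-flip₁₂ : ∀ {a b d β} → Distinct3 a b d → r₄ (a , b , d) ≡ not β → r₄ (b , a , d) ≡ β
  r₄-flip₁₂ {β = β} abd abd≡¬β =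
    trans (r₄-swap₁₂ abd) (trans (cong not abd≡¬β) (not-involutive β))

  r₄-flip₂₃ : ∀ {a b d β} → Distinct3 a b d → r₄ (a , b , d) ≡ not β → r₄ (a , d , b) ≡ β
  r₄-flip₂₃ {β = β} abd abd≡¬β =
    trans (r₄-swap₂₃ abd) (trans (cong not abd≡¬β) (not-involutive β))

  Nabla-cyc⇔R₄ : ∀ {x y z} → x ≢ y → Nabla c (cyc x y z) ⇔ c (x , y , z) ≡ # 4
  Nabla-cyc⇔R₄ {x} {y} {z} x≢y =
    mk⇔ in-R₄ (λ xyz∈R₄ → x , y , z , R₄⇒Distinct3 xyz∈R₄ , (λ _ → refl) , xyz∈R₄)
    where
    in-R₄ : Nabla c (cyc x y z) → c (x , y , z) ≡ # 4
    in-R₄ N@(_ , _ , _ , abd , f≗g , abd∈R₄) = R₄-Rotation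
      (cyc-≗⇒Rotation (IsThreeCycle-cyc⇒Distinct3 x≢y (Nabla⇒IsThreeCycle N)) abd f≗g)
      abd∈R₄

  isYes-Nabla-cyc : ∀ {x y z} → x ≢ y → isYes (Nabla? c (cyc x y z)) ≡ r₄ (x , y , z)
  isYes-Nabla-cyc x≢y = isYes-⇔ (Nabla-cyc⇔R₄ x≢y) _ _

  ind-Nabla-cyc : ∀ {x y z} → x ≢ y → ind (Nabla? c (cyc x y z)) ≡ 𝟙 (r₄ (x , y , z))
  ind-Nabla-cyc x≢y = cong 𝟙 (isYes-Nabla-cyc x≢y)

  Nabla-cyc-exactly-one : ∀ {x y z} → Distinct3 x y z →
      (Nabla c (cyc x y z) × ¬ Nabla c (cyc x z y))
    ⊎ (¬ Nabla c (cyc x y z) × Nabla c (cyc x z y))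
  Nabla-cyc-exactly-one {x} {y} {z} xyz@(x≢y , _ , x≢z) =
    exactly-one (Nabla? c (cyc x y z)) (Nabla? c (cyc x z y))
      (trans (isYes-Nabla-cyc x≢z)
        (trans (r₄-swap₂₃ xyz) (cong not (sym (isYes-Nabla-cyc x≢y)))))

  Nabla-regular : ∃[ k ] (∀ x y → x ≢ y → card (λ z → Nabla? c (cyc x y z)) ≡ k)
  Nabla-regular = proj₁ valency (# 4) , λ x y x≢y →
    trans (card-cong _ (λ z → c (z , x , y) ≟ # 4)
            ( (λ N → R₄-rotate (R₄-rotate (to (Nabla-cyc⇔R₄ x≢y) N)))
            , (λ zxy∈R₄ → from (Nabla-cyc⇔R₄ x≢y) (R₄-rotate zxy∈R₄))))
          (proj₂ valency x y x≢y (# 4))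

  module _ (p₄₄₄⁴≡0 : p (# 4) (# 4) (# 4) (# 4) ≡ 0) where

    no-R₄-configuration : ∀ {x y z w} →
      r₄ (x , y , z) ≡ true → r₄ (w , y , z) ≡ true → r₄ (x , w , z) ≡ true →
      r₄ (x , y , w) ≡ true → ⊥
    no-R₄-configuration e₁ e₂ e₃ e₄ = intersection≡0⇒no-configuration isATS p₄₄₄⁴≡0
      (r₄≡true⇒R₄ _ e₁) (r₄≡true⇒R₄ _ e₂) (r₄≡true⇒R₄ _ e₃) (r₄≡true⇒R₄ _ e₄)

    no-monochromatic-configuration : ∀ {x y z w} → Distinct4 x y z w → ∀ β →
      r₄ (x , y , z) ≡ β → r₄ (w , y , z) ≡ β → r₄ (x , w , z) ≡ β → r₄ (x , y , w) ≡ β → ⊥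
    no-monochromatic-configuration _ true = no-R₄-configuration
    no-monochromatic-configuration (x≢y , x≢z , x≢w , y≢z , y≢w , z≢w) false e₁ e₂ e₃ e₄ =
      no-R₄-configuration
        (r₄-flip₁₂ (x≢y , y≢z , x≢z) e₁)
        (r₄-flip₁₂ (x≢w , ≢-sym z≢w , x≢z) e₃)
        (r₄-flip₁₂ (≢-sym y≢w , y≢z , ≢-sym z≢w) e₂)
        (r₄-flip₁₂ (x≢y , y≢w , x≢w) e₄)

    no-odd-face : ∀ {x y z w α β γ δ} → Distinct4 x y z w →
      r₄ (x , y , z) ≡ α → r₄ (x , w , y) ≡ β → r₄ (x , z , w) ≡ γ → r₄ (y , w , z) ≡ δ →
      ¬ OddOneOut α β γ δ
    no-odd-face {x} {y} {z} {w} D@(x≢y , x≢z , x≢w , y≢z , y≢w , z≢w) refl refl refl refl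
                (β≡¬α , γ≡¬α , δ≡¬α) =
      no-monochromatic-configuration D (r₄ (x , y , z)) refl
        (r₄-flip₁₂ (y≢w , ≢-sym z≢w , y≢z) δ≡¬α)
        (r₄-flip₂₃ (x≢z , z≢w , x≢w) γ≡¬α)
        (r₄-flip₂₃ (x≢w , ≢-sym y≢w , x≢y) β≡¬α)

    boundary-even : ∀ {x y z w} → Distinct4 x y z w →
      ∃[ k ] (𝟙 (r₄ (x , y , z)) + 𝟙 (r₄ (x , w , y)) + 𝟙 (r₄ (x , z , w)) + 𝟙 (r₄ (y , w , z))
              ≡ 2 * k)
    boundary-even {x} {y} {z} {w} D@(x≢y , x≢z , x≢w , y≢z , y≢w , z≢w) =
      even-unless-odd-one-out _ _ _ _
        (no-odd-face D refl refl refl refl)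
        -- the even relabellings (x,w,y,z), (x,z,w,y), (y,w,z,x) bring the second,
        -- third and fourth face to the front, each face only rotated
        (no-odd-face (x≢w , x≢y , x≢z , ≢-sym y≢w , ≢-sym z≢w , y≢z)
          refl refl refl (r₄-rotate y w z))
        (no-odd-face (x≢z , x≢w , x≢y , z≢w , ≢-sym y≢z , ≢-sym y≢w)
          refl refl refl (r₄-rotate² y w z))
        (no-odd-face (y≢w , y≢z , ≢-sym x≢y , ≢-sym z≢w , ≢-sym x≢w , ≢-sym x≢z)
          refl (r₄-rotate² x w y) (r₄-rotate x y z) (r₄-rotate² x z w))

    Nabla-boundary-even : ∀ {x y z w} → Distinct3 x y z → x ≢ w → y ≢ w → z ≢ w →
      ∃[ k ] (ind (Nabla? c (cyc x y z)) + ind (Nabla? c (cyc x w y))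
              + ind (Nabla? c (cyc x z w)) + ind (Nabla? c (cyc y w z)) ≡ 2 * k)
    Nabla-boundary-even {x} {y} {z} {w} (x≢y , y≢z , x≢z) x≢w y≢w z≢w
      rewrite ind-Nabla-cyc {z = z} x≢y | ind-Nabla-cyc {z = y} x≢w
            | ind-Nabla-cyc {z = w} x≢z | ind-Nabla-cyc {z = z} y≢w
      = boundary-even (x≢y , x≢z , x≢w , y≢z , y≢w , z≢w)

-- Only p₄₄₄⁴ = 0 is needed: by skew-symmetry, relabelling the four points turns every
-- configuration counted by p₄₄₅⁵, p₄₅₅⁴ or p₅₅₅⁵ into one counted by p₄₄₄⁴.
theorem3p3 : ∀ (n : ℕ) (c : Triple n → Fin 6)
               (p : Fin 6 → Fin 6 → Fin 6 → Fin 6 → ℕ) →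
               IsSkewATS6 n c p →
               p (# 4) (# 4) (# 4) (# 4) ≡ 0 →
               p (# 4) (# 4) (# 5) (# 5) ≡ 0 →
               p (# 4) (# 5) (# 5) (# 4) ≡ 0 →
               p (# 5) (# 5) (# 5) (# 5) ≡ 0 →
               IsRegularSkewTwoGraph n (Nabla c) (Nabla? c)
theorem3p3 n c p S p₄₄₄⁴≡0 _ _ _ = record
  { skewTwoGraph = record
    { subset = λ _ → Nabla⇒IsThreeCycle
    ; S1     = λ _ _ _ → Nabla-cyc-exactly-one
    ; S2     = λ _ _ _ _ → Nabla-boundary-even p₄₄₄⁴≡0
    }
  ; regular = Nabla-regular
  }
  where open SkewSymmetricScheme S
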